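{- Let $\mathcal{S}$, $\mathcal{M}_2$, $\mathcal{MM}_2$ and the map $\phi$ be as described in the context, and let $f:\mathcal{MM}_2\to\mathcal{M}_2$ be the map which forgets the marking (keeping the underlying path and colours). Then $f\circ\phi:\mathcal{S}\to\mathcal{M}_2$ is a length-preserving bijection.
   Context: A quarter plane walk is a finite walk in $\mathbb{Z}^2$ starting at $(0,0)$, staying in $\{(i,j): i\ge 0, j\ge 0\}$, using steps from a given set; its length is its number of steps. $\mathcal{S}$ is the class of quarter plane walks with steps from $\{(1,0),(1,-1),(0,-1),(-1,0),(-1,1),(0,1)\}$, written $\rightarrow,\searrow,\downarrow,\leftarrow,\nwarrow,\uparrow$ respectively. A Motzkin path is a walk from $(0,0)$ using the steps $\nearrow=(1,1)$, $\rightarrow=(1,0)$, $\searrow=(1,-1)$, never going below the $x$-axis and ending on the $x$-axis. $\mathcal{M}_2$ is the class of bicoloured Motzkin paths (each step coloured red or black); $\mathcal{MM}_2$ is the class of bicoloured Motzkin paths in which each step is additionally either marked or unmarked. The map $\phi$: given $w\in\mathcal{S}$, start with the empty path $m$ and read the steps of $w$ from first to last, modifying $m$ as follows. (1) Step $\uparrow$: append a marked red $\rightarrow$ to $m$. (2) Step $\rightarrow$: append a marked black $\rightarrow$ to $m$. (3) Step $\searrow$: find the rightmost step of $m$ that is either a marked red $\rightarrow$ or a marked black $\searrow$; if it is a marked red $\rightarrow$ replace it by an unmarked red $\nearrow$, if it is a marked black $\searrow$ replace it by an unmarked black $\rightarrow$. Then append a marked red $\searrow$. (4) Step $\nwarrow$: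 find the rightmost step of $m$ that is either a marked black $\rightarrow$ or a marked red $\searrow$; if it is a marked black $\rightarrow$ replace it by an unmarked black $\nearrow$, if it is a marked red $\searrow$ replace it by an unmarked red $\rightarrow$. Then append a marked black $\searrow$. (5) Step $\leftarrow$: perform the same search and replacement as in (4), then append an unmarked red $\searrow$. (6) Step $\downarrow$: perform the same search and replacement as in (3), then append an unmarked black $\searrow$. The final $m$ is $\phi(w)$. -}

module Defs where

open import Data.Nat using (ℕ; zero; suc)
open import Data.Bool using (Bool; true; false)
open import Data.List using (List; []; _∷_; reverse; foldl; map; _++_; [_])
open import Data.Maybe using (Maybe; just; nothing)
open import Data.Unit using (⊤)
open import Data.Empty using (⊥)
open import Data.Product using (_×_; _,_)
open import Relation.Binary.PropositionalEquality using (_≡_)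

data SStep : Set where
  E SE S W NW N : SStep     -- (1,0) (1,-1) (0,-1) (-1,0) (-1,1) (0,1)

QPFrom : ℕ → ℕ → List SStep → Set
QPFrom i j [] = ⊤
QPFrom i j (E ∷ w) = QPFrom (suc i) j w
QPFrom i zero (SE ∷ w) = ⊥
QPFrom i (suc j) (SE ∷ w) = QPFrom (suc i) j w
QPFrom i zero (S ∷ w) = ⊥
QPFrom i (suc j) (S ∷ w) = QPFrom i j w
QPFrom zero j (W ∷ w) = ⊥
QPFrom (suc i) j (W ∷ w) = QPFrom i j w
QPFrom zero j (NW ∷ w) = ⊥
QPFrom (suc i) j (NW ∷ w) = QPFrom i (suc j) w
QPFrom i j (N ∷ w) = QPFrom i (suc j) w

InS : List SStep → Set
InS w = QPFrom 0 0 w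

data Dir : Set where
  up flat down : Dir

data Colour : Set where
  red black : Colour

BStep : Set
BStep = Colour × Dir

-- a bicoloured, marked step: (marked?, colour, direction)
MStep : Set
MStep = Bool × BStep

MotzFrom : ℕ → List Dir → Set
MotzFrom zero [] = ⊤
MotzFrom (suc h) [] = ⊥
MotzFrom h (up ∷ p) = MotzFrom (suc h) p
MotzFrom h (flat ∷ p) = MotzFrom h p
MotzFrom zero (down ∷ p) = ⊥
MotzFrom (suc h) (down ∷ p) = MotzFrom h p

InM2 : List BStep → Set
InM2 p = MotzFrom 0 (map (λ s → Data.Product.proj₂ s) p)

replaceFirst : {A : Set} → (A → Maybe A) → List A → List A
replaceFirst f [] = []
replaceFirst f (x ∷ xs) with f x
... | just y = y ∷ xs
... | nothing = x ∷ replaceFirst f xs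

replaceLast : {A : Set} → (A → Maybe A) → List A → List A
replaceLast f xs = reverse (replaceFirst f (reverse xs))

repl3 : MStep → Maybe MStep
repl3 (true , red , flat) = just (false , red , up)
repl3 (true , black , down) = just (false , black , flat)
repl3 _ = nothing

repl4 : MStep → Maybe MStep
repl4 (true , black , flat) = just (false , black , up)
repl4 (true , red , down) = just (false , red , flat)
repl4 _ = nothing

φstep : List MStep → SStep → List MStep
φstep m N  = m ++ [ (true , red , flat) ]
φstep m E  = m ++ [ (true , black , flat) ]
φstep m SE = replaceLast repl3 m ++ [ (true , red , down) ]
φstep m NW = replaceLast repl4 m ++ [ (true , black , down) ]
φstep m W  = replaceLast repl4 m ++ [ (false , red , down) ]
φstep m S  = replaceLast repl3 m ++ [ (false , black , down) ]

φ : List SStep → List MStep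
φ w = foldl φstep [] w

forget : List MStep → List BStep
forget = map (λ s → Data.Product.proj₂ s)

-- φ is inverted by reading a bicoloured Motzkin path from left to right with the
-- transducer δ below, which marks each step and emits a walk step; call a marked path
-- canonical when its marks are the ones δ assigns.  In a canonical path, the rightmost
-- step matched by rule (3) (or (4)) is a step whose increment of the walk is never
-- undone; replacing it makes that increment undone by the step being appended, which
-- raises one component of every later state of δ by one and changes no later mark or
-- emitted step.  So every φ w is canonical and δ reads w back from it, which gives
-- injectivity; the components of the state sum to the height, which gives the Motzkin
-- property; and the marked steps count the position of the walk, so the replacement
-- required by rules (3)–(6) exists exactly when the walk stays in the quarter plane.
-- Conversely a canonical path is φ of the walk δ reads from it, by induction on its
-- length: the last step is removed after undoing rule (3) or (4) at the last point
-- where the affected component of the state vanishes.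

module Submission where

open import Defs
open import Data.Bool using (true; false)
open import Data.Empty using (⊥-elim)
open import Data.List using (List; []; _∷_; _++_; [_]; _∷ʳ_; length; map; reverse; foldl; initLast; _∷ʳ′_)
open import Data.List.Properties using (length-map; length-++; length-reverse; reverse-++; unfold-reverse; reverse-involutive; ++-assoc; ++-identityʳ; foldl-++)
open import Data.List.Relation.Unary.All using (All; []; _∷_)
open import Data.List.Relation.Unary.All.Properties using (++⁺)
open import Data.Maybe using (Maybe; just; nothing)
open import Data.Nat using (ℕ; zero; suc; pred; _+_; _<_; z<s)
open import Data.Nat.Properties using (suc-injective; +-assoc; +-comm; +-suc; +-identityʳ; ≤-trans; m≤n+m; >⇒≢; 1+n≢0)
open import Data.Product using (_×_; ∃; _,_; proj₁; proj₂)
open import Data.Sum using (_⊎_; inj₁; inj₂)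
open import Data.Unit using (⊤; tt)
open import Function using (id; _∘_)
open import Relation.Binary.PropositionalEquality using (_≡_; refl; sym; trans; cong; cong₂; subst; module ≡-Reasoning)
open import Relation.Nullary.Negation using (contradiction)

open ≡-Reasoning

weight : {A : Set} → Maybe A → ℕ
weight (just _) = 1
weight nothing  = 0

count : {A : Set} → (A → Maybe A) → List A → ℕ
count f []       = 0
count f (x ∷ xs) = weight (f x) + count f xs

Unmatched : {A : Set} → (A → Maybe A) → List A → Set
Unmatched f = All (λ x → f x ≡ nothing)

data RightmostMatch {A : Set} (f : A → Maybe A) : List A → Set where
  rightmost : ∀ pre {x y} post → f x ≡ just y → Unmatched f post → RightmostMatch f (pre ++ x ∷ post)

all-reverse : {A : Set} {P : A → Set} {xs : List A} → All P xs → All P (reverse xs)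
all-reverse []                    = []
all-reverse {xs = x ∷ xs} (p ∷ ps) = subst (All _) (sym (unfold-reverse x xs)) (++⁺ (all-reverse ps) (p ∷ []))

reverse-around : {A : Set} (xs : List A) (x : A) (ys : List A) → reverse (xs ++ x ∷ ys) ≡ reverse ys ++ x ∷ reverse xs
reverse-around xs x ys = begin
  reverse (xs ++ x ∷ ys)             ≡⟨ reverse-++ xs (x ∷ ys) ⟩
  reverse (x ∷ ys) ++ reverse xs     ≡⟨ cong (_++ reverse xs) (unfold-reverse x ys) ⟩
  (reverse ys ∷ʳ x) ++ reverse xs    ≡⟨ ++-assoc (reverse ys) [ x ] (reverse xs) ⟩
  reverse ys ++ x ∷ reverse xs       ∎

length-∷ʳ : {A : Set} (xs : List A) (y : A) → length (xs ++ [ y ]) ≡ suc (length xs)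
length-∷ʳ xs y = trans (length-++ xs) (+-comm (length xs) 1)

module _ {A : Set} {f : A → Maybe A} where

  count-++ : ∀ xs ys → count f (xs ++ ys) ≡ count f xs + count f ys
  count-++ []       ys = refl
  count-++ (x ∷ xs) ys = trans (cong (weight (f x) +_) (count-++ xs ys)) (sym (+-assoc (weight (f x)) _ _))

  count-∷ʳ : ∀ xs y → count f (xs ++ [ y ]) ≡ weight (f y) + count f xs
  count-∷ʳ xs y = begin
    count f (xs ++ [ y ])               ≡⟨ count-++ xs [ y ] ⟩
    count f xs + (weight (f y) + 0)     ≡⟨ cong (count f xs +_) (+-identityʳ _) ⟩
    count f xs + weight (f y)           ≡⟨ +-comm (count f xs) _ ⟩
    weight (f y) + count f xs           ∎

  count-reverse : ∀ xs → count f (reverse xs) ≡ count f xs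
  count-reverse []       = refl
  count-reverse (x ∷ xs) = begin
    count f (reverse (x ∷ xs))            ≡⟨ cong (count f) (unfold-reverse x xs) ⟩
    count f (reverse xs ++ [ x ])         ≡⟨ count-∷ʳ (reverse xs) x ⟩
    weight (f x) + count f (reverse xs)   ≡⟨ cong (weight (f x) +_) (count-reverse xs) ⟩
    count f (x ∷ xs)                      ∎

  count-unmatched : ∀ {xs} → Unmatched f xs → count f xs ≡ 0
  count-unmatched []         = refl
  count-unmatched (e ∷ none) = cong₂ _+_ (cong weight e) (count-unmatched none)

  count-match : ∀ pre {x y} post → f x ≡ just y → 0 < count f (pre ++ x ∷ post)
  count-match []        post e rewrite e = z<s
  count-match (z ∷ pre) post e = ≤-trans (count-match pre post e) (m≤n+m _ (weight (f z)))

  rightmostMatch? : ∀ xs → RightmostMatch f xs ⊎ Unmatched f xs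
  rightmostMatch? []       = inj₂ []
  rightmostMatch? (x ∷ xs) with rightmostMatch? xs
  ... | inj₁ (rightmost pre post e none) = inj₁ (rightmost (x ∷ pre) post e none)
  ... | inj₂ none with f x in e
  ...   | just _  = inj₁ (rightmost [] xs e none)
  ...   | nothing = inj₂ (e ∷ none)

  rightmostMatch : ∀ xs → 0 < count f xs → RightmostMatch f xs
  rightmostMatch xs h with rightmostMatch? xs
  ... | inj₁ match = match
  ... | inj₂ none  = contradiction (count-unmatched none) (>⇒≢ h)

  replaceFirst-leftmost : ∀ {pre x y} post → Unmatched f pre → f x ≡ just y →
                          replaceFirst f (pre ++ x ∷ post) ≡ pre ++ y ∷ post
  replaceFirst-leftmost post []         e rewrite e = refl
  replaceFirst-leftmost post (n ∷ none) e rewrite n = cong (_ ∷_) (replaceFirst-leftmost post none e)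

  replaceLast-rightmost : ∀ pre {x y} post → f x ≡ just y → Unmatched f post →
                          replaceLast f (pre ++ x ∷ post) ≡ pre ++ y ∷ post
  replaceLast-rightmost pre {x} {y} post e none = begin
    reverse (replaceFirst f (reverse (pre ++ x ∷ post)))          ≡⟨ cong (reverse ∘ replaceFirst f) (reverse-around pre x post) ⟩
    reverse (replaceFirst f (reverse post ++ x ∷ reverse pre))    ≡⟨ cong reverse (replaceFirst-leftmost (reverse pre) (all-reverse none) e) ⟩
    reverse (reverse post ++ y ∷ reverse pre)                     ≡⟨ reverse-around (reverse post) y (reverse pre) ⟩
    reverse (reverse pre) ++ y ∷ reverse (reverse post)           ≡⟨ cong₂ (λ u v → u ++ y ∷ v) (reverse-involutive pre) (reverse-involutive post) ⟩
    pre ++ y ∷ post                                               ∎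

  length-replaceFirst : ∀ xs → length (replaceFirst f xs) ≡ length xs
  length-replaceFirst []       = refl
  length-replaceFirst (x ∷ xs) with f x
  ... | just _  = refl
  ... | nothing = cong suc (length-replaceFirst xs)

  length-replaceLast : ∀ xs → length (replaceLast f xs) ≡ length xs
  length-replaceLast xs = trans (length-reverse (replaceFirst f (reverse xs))) (trans (length-replaceFirst (reverse xs)) (length-reverse xs))

module _ {A : Set} {f : A → Maybe A} (unmatched-image : ∀ {x y} → f x ≡ just y → f y ≡ nothing) where

  count-replaceFirst : ∀ xs → count f (replaceFirst f xs) ≡ pred (count f xs)
  count-replaceFirst []       = refl
  count-replaceFirst (x ∷ xs) with f x in e
  ... | just _  = cong (λ z → weight z + count f xs) (unmatched-image e)
  ... | nothing = trans (cong (λ z → weight z + count f (replaceFirst f xs)) e) (count-replaceFirst xs)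

  count-replaceLast : ∀ xs → count f (replaceLast f xs) ≡ pred (count f xs)
  count-replaceLast xs = begin
    count f (reverse (replaceFirst f (reverse xs)))  ≡⟨ count-reverse (replaceFirst f (reverse xs)) ⟩
    count f (replaceFirst f (reverse xs))            ≡⟨ count-replaceFirst (reverse xs) ⟩
    pred (count f (reverse xs))                      ≡⟨ cong pred (count-reverse xs) ⟩
    pred (count f xs)                                ∎

module _ {A : Set} {f g : A → Maybe A} (disjoint : ∀ {x y} → f x ≡ just y → g x ≡ nothing × g y ≡ nothing) where

  count-replaceFirst-other : ∀ xs → count g (replaceFirst f xs) ≡ count g xs
  count-replaceFirst-other []       = refl
  count-replaceFirst-other (x ∷ xs) with f x in e
  ... | just _  = cong (_+ count g xs) (trans (cong weight (proj₂ (disjoint e))) (sym (cong weight (proj₁ (disjoint e)))))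
  ... | nothing = cong (weight (g x) +_) (count-replaceFirst-other xs)

  count-replaceLast-other : ∀ xs → count g (replaceLast f xs) ≡ count g xs
  count-replaceLast-other xs = begin
    count g (reverse (replaceFirst f (reverse xs)))  ≡⟨ count-reverse (replaceFirst f (reverse xs)) ⟩
    count g (replaceFirst f (reverse xs))            ≡⟨ count-replaceFirst-other (reverse xs) ⟩
    count g (reverse xs)                             ≡⟨ count-reverse xs ⟩
    count g xs                                       ∎

State : Set
State = ℕ × ℕ

-- In state (a , b), a (resp. b) counts the increments of the second (resp. first)
-- coordinate of the walk that a later step of the path undoes; a step is marked iff
-- it makes an increment that is never undone.  A ↘ in state (0 , 0) has no valid
-- reading: it is sent to a marked →, so that no path containing it is canonical.
δ : State → BStep → State × MStep × SStep
δ (a , b)        (red , up)     = (suc a , b)   , (false , red , up)     , N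
δ (a , b)        (black , up)   = (a , suc b)   , (false , black , up)   , E
δ (zero , b)     (red , flat)   = (zero , b)    , (true , red , flat)    , N
δ (suc a , b)    (red , flat)   = (a , suc b)   , (false , red , flat)   , SE
δ (a , zero)     (black , flat) = (a , zero)    , (true , black , flat)  , E
δ (a , suc b)    (black , flat) = (suc a , b)   , (false , black , flat) , NW
δ (a , suc b)    (red , down)   = (a , b)       , (false , red , down)   , W
δ (suc a , zero) (red , down)   = (a , zero)    , (true , red , down)    , SE
δ (zero , zero)  (red , down)   = (zero , zero) , (true , red , flat)    , W
δ (suc a , b)    (black , down) = (a , b)       , (false , black , down) , S
δ (zero , suc b) (black , down) = (zero , b)    , (true , black , down)  , NW
δ (zero , zero)  (black , down) = (zero , zero) , (true , black , flat)  , S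

next : State → BStep → State
next t c = proj₁ (δ t c)

mark : State → BStep → MStep
mark t c = proj₁ (proj₂ (δ t c))

emit : State → BStep → SStep
emit t c = proj₂ (proj₂ (δ t c))

endState : State → List BStep → State
endState t []      = t
endState t (c ∷ p) = endState (next t c) p

walkOf : State → List BStep → List SStep
walkOf t []      = []
walkOf t (c ∷ p) = emit t c ∷ walkOf (next t c) p

marking : State → List BStep → List MStep
marking t []      = []
marking t (c ∷ p) = mark t c ∷ marking (next t c) p

Canonical : State → List MStep → Set
Canonical t []      = ⊤
Canonical t (y ∷ m) = mark t (proj₂ y) ≡ y × Canonical (next t (proj₂ y)) m

AllAlong : (State → Set) → State → List MStep → Set
AllAlong P t []      = P t
AllAlong P t (y ∷ m) = P t × AllAlong P (next t (proj₂ y)) m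

along-head : ∀ {P t} m → AllAlong P t m → P t
along-head []      p       = p
along-head (_ ∷ _) (p , _) = p

endState-++ : ∀ t xs ys → endState t (forget (xs ++ ys)) ≡ endState (endState t (forget xs)) (forget ys)
endState-++ t []       ys = refl
endState-++ t (x ∷ xs) ys = endState-++ (next t (proj₂ x)) xs ys

walkOf-++ : ∀ t xs ys → walkOf t (forget (xs ++ ys)) ≡ walkOf t (forget xs) ++ walkOf (endState t (forget xs)) (forget ys)
walkOf-++ t []       ys = refl
walkOf-++ t (x ∷ xs) ys = cong (emit t (proj₂ x) ∷_) (walkOf-++ (next t (proj₂ x)) xs ys)

canonical-++⁻ : ∀ t xs {ys} → Canonical t (xs ++ ys) → Canonical t xs × Canonical (endState t (forget xs)) ys
canonical-++⁻ t []       c        = tt , c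
canonical-++⁻ t (x ∷ xs) (ok , c) = let (cxs , cys) = canonical-++⁻ (next t (proj₂ x)) xs c in (ok , cxs) , cys

canonical-++⁺ : ∀ t xs {ys} → Canonical t xs → Canonical (endState t (forget xs)) ys → Canonical t (xs ++ ys)
canonical-++⁺ t []       _         cys = cys
canonical-++⁺ t (x ∷ xs) (ok , cxs) cys = ok , canonical-++⁺ (next t (proj₂ x)) xs cxs cys

record Rule : Set where
  field
    repl         : MStep → Maybe MStep
    raise        : State → State
    level        : State → ℕ
    level-origin : level (0 , 0) ≡ 0
    level-raise  : ∀ t → 0 < level (raise t)
    raise-injective : ∀ {s t} → raise s ≡ raise t → s ≡ t
    shift-step   : ∀ t y → mark t (proj₂ y) ≡ y → repl y ≡ nothing →
                   mark (raise t) (proj₂ y) ≡ y × next (raise t) (proj₂ y) ≡ raise (next t (proj₂ y))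
                   × emit (raise t) (proj₂ y) ≡ emit t (proj₂ y)
    unshift-step : ∀ t y → mark (raise t) (proj₂ y) ≡ y → 0 < level (next (raise t) (proj₂ y)) →
                   mark t (proj₂ y) ≡ y × repl y ≡ nothing
    pop-step     : ∀ t {x y} → repl x ≡ just y → mark t (proj₂ x) ≡ x →
                   mark t (proj₂ y) ≡ y × next t (proj₂ y) ≡ raise (next t (proj₂ x))
                   × emit t (proj₂ y) ≡ emit t (proj₂ x)
    unpop-step   : ∀ t c → level t ≡ 0 → 0 < level (next t c) →
                   ∃ λ x → repl x ≡ just (mark t c) × mark t (proj₂ x) ≡ x

module Popping (rule : Rule) where
  open Rule rule

  Positive : State → Set
  Positive t = 0 < level t

  shift : ∀ {t} m → Canonical t m → Unmatched repl m →
          Canonical (raise t) m × endState (raise t) (forget m) ≡ raise (endState t (forget m))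
          × walkOf (raise t) (forget m) ≡ walkOf t (forget m)
  shift []      _        _           = tt , refl , refl
  shift {t} (y ∷ m) (ok , c) (none ∷ nones) with shift-step t y ok none
  ... | same-mark , same-next , same-emit with shift m c nones
  ...   | c′ , e , w rewrite same-next | same-emit = (same-mark , c′) , e , cong (emit t (proj₂ y) ∷_) w

  unshift : ∀ {t} m → Canonical (raise t) m → AllAlong Positive (raise t) m → Canonical t m × Unmatched repl m
  unshift []      _        _         = tt , []
  unshift {t} (y ∷ m) (ok , c) (_ , pos) with unshift-step t y ok (along-head m pos)
  ... | ok′ , none with shift-step t y ok′ none
  ...   | _ , same-next , _ rewrite same-next with unshift m c pos
  ...     | c′ , nones = (ok′ , c′) , none ∷ nones

  pop : ∀ {s} m → Canonical s m → 0 < count repl m →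
        Canonical s (replaceLast repl m) × endState s (forget (replaceLast repl m)) ≡ raise (endState s (forget m))
        × walkOf s (forget (replaceLast repl m)) ≡ walkOf s (forget m)
  pop {s} m c h with rightmostMatch m h
  ... | rightmost pre {x} {y} post x↦y nones
      rewrite replaceLast-rightmost pre post x↦y nones
      with canonical-++⁻ s pre c
  ... | c-pre , x-ok , c-post with pop-step (endState s (forget pre)) x↦y x-ok
  ... | y-ok , y-next , y-emit with shift post c-post nones
  ... | c-post′ , e-post , w-post =
    canonical-++⁺ s pre c-pre (y-ok , subst (λ t → Canonical t post) (sym y-next) c-post′) , end-raised , walk-same
    where
      u : State
      u = endState s (forget pre)
      end-raised : endState s (forget (pre ++ y ∷ post)) ≡ raise (endState s (forget (pre ++ x ∷ post)))
      end-raised = begin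
        endState s (forget (pre ++ y ∷ post))              ≡⟨ endState-++ s pre (y ∷ post) ⟩
        endState (next u (proj₂ y)) (forget post)          ≡⟨ cong (λ t → endState t (forget post)) y-next ⟩
        endState (raise (next u (proj₂ x))) (forget post)  ≡⟨ e-post ⟩
        raise (endState (next u (proj₂ x)) (forget post))  ≡⟨ cong raise (sym (endState-++ s pre (x ∷ post))) ⟩
        raise (endState s (forget (pre ++ x ∷ post)))      ∎
      walk-same : walkOf s (forget (pre ++ y ∷ post)) ≡ walkOf s (forget (pre ++ x ∷ post))
      walk-same = begin
        walkOf s (forget (pre ++ y ∷ post))                                        ≡⟨ walkOf-++ s pre (y ∷ post) ⟩
        walkOf s (forget pre) ++ emit u (proj₂ y) ∷ walkOf (next u (proj₂ y)) (forget post)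
          ≡⟨ cong (λ t → walkOf s (forget pre) ++ emit u (proj₂ y) ∷ walkOf t (forget post)) y-next ⟩
        walkOf s (forget pre) ++ emit u (proj₂ y) ∷ walkOf (raise (next u (proj₂ x))) (forget post)
          ≡⟨ cong₂ (λ e w → walkOf s (forget pre) ++ e ∷ w) y-emit w-post ⟩
        walkOf s (forget pre) ++ emit u (proj₂ x) ∷ walkOf (next u (proj₂ x)) (forget post)
          ≡⟨ sym (walkOf-++ s pre (x ∷ post)) ⟩
        walkOf s (forget (pre ++ x ∷ post))                                        ∎

  data LastZero (s : State) : List MStep → Set where
    lastZero : ∀ pre y post → level (endState s (forget pre)) ≡ 0 →
               AllAlong Positive (next (endState s (forget pre)) (proj₂ y)) post → LastZero s (pre ++ y ∷ post)

  lastZero? : ∀ s m → Positive (endState s (forget m)) → AllAlong Positive s m ⊎ LastZero s m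
  lastZero? s []      p = inj₁ p
  lastZero? s (y ∷ m) p with lastZero? (next s (proj₂ y)) m p
  ... | inj₂ (lastZero pre z post e q) = inj₂ (lastZero (y ∷ pre) z post e q)
  ... | inj₁ q with level s in e
  ...   | zero  = inj₂ (lastZero [] y m e q)
  ...   | suc _ = inj₁ (z<s , q)

  unpop : ∀ {s t} m → Canonical s m → level s ≡ 0 → endState s (forget m) ≡ raise t →
          ∃ λ m₀ → Canonical s m₀ × endState s (forget m₀) ≡ t × replaceLast repl m₀ ≡ m × 0 < count repl m₀
  unpop {s} {t} m c z e with lastZero? s m (subst Positive (sym e) (level-raise t))
  ... | inj₁ q = contradiction z (>⇒≢ (along-head m q))
  ... | inj₂ (lastZero pre y post z′ q) with canonical-++⁻ s pre c
  ... | c-pre , y-ok , c-post with unpop-step (endState s (forget pre)) (proj₂ y) z′ (along-head post q)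
  ... | x , x↦my , x-ok with trans x↦my (cong just y-ok)
  ... | x↦y with pop-step (endState s (forget pre)) x↦y x-ok
  ... | _ , y-next , _ rewrite y-next with unshift post c-post q
  ... | c-post′ , nones with shift post c-post′ nones
  ... | _ , e-post , _ =
    pre ++ x ∷ post , canonical-++⁺ s pre c-pre (x-ok , c-post′) , end-lowered ,
    replaceLast-rightmost pre post x↦y nones , count-match pre post x↦y
    where
      u : State
      u = endState s (forget pre)
      end-lowered : endState s (forget (pre ++ x ∷ post)) ≡ t
      end-lowered = raise-injective (begin
        raise (endState s (forget (pre ++ x ∷ post)))      ≡⟨ cong raise (endState-++ s pre (x ∷ post)) ⟩
        raise (endState (next u (proj₂ x)) (forget post))  ≡⟨ sym e-post ⟩
        endState (raise (next u (proj₂ x))) (forget post)  ≡⟨ cong (λ v → endState v (forget post)) (sym y-next) ⟩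
        endState (next u (proj₂ y)) (forget post)          ≡⟨ sym (endState-++ s pre (y ∷ post)) ⟩
        endState s (forget (pre ++ y ∷ post))              ≡⟨ e ⟩
        raise t                                            ∎)

raise₃ raise₄ : State → State
raise₃ (a , b) = suc a , b
raise₄ (a , b) = a , suc b

shift-step₃ : ∀ t y → mark t (proj₂ y) ≡ y → repl3 y ≡ nothing →
              mark (raise₃ t) (proj₂ y) ≡ y × next (raise₃ t) (proj₂ y) ≡ raise₃ (next t (proj₂ y))
              × emit (raise₃ t) (proj₂ y) ≡ emit t (proj₂ y)
shift-step₃ t              (_ , red , up)     refl _ = refl , refl , refl
shift-step₃ t              (_ , black , up)   refl _ = refl , refl , refl
shift-step₃ (zero , b)     (_ , red , flat)   refl ()
shift-step₃ (suc a , b)    (_ , red , flat)   refl _ = refl , refl , refl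
shift-step₃ (a , zero)     (_ , black , flat) refl _ = refl , refl , refl
shift-step₃ (a , suc b)    (_ , black , flat) refl _ = refl , refl , refl
shift-step₃ (a , suc b)    (_ , red , down)   refl _ = refl , refl , refl
shift-step₃ (suc a , zero) (_ , red , down)   refl _ = refl , refl , refl
shift-step₃ (zero , zero)  (_ , red , down)   ()   _
shift-step₃ (suc a , b)    (_ , black , down) refl _ = refl , refl , refl
shift-step₃ (zero , suc b) (_ , black , down) refl ()
shift-step₃ (zero , zero)  (_ , black , down) ()   _

unshift-step₃ : ∀ t y → mark (raise₃ t) (proj₂ y) ≡ y → 0 < proj₁ (next (raise₃ t) (proj₂ y)) →
                mark t (proj₂ y) ≡ y × repl3 y ≡ nothing
unshift-step₃ t              (_ , red , up)     refl _  = refl , refl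
unshift-step₃ t              (_ , black , up)   refl _  = refl , refl
unshift-step₃ (zero , b)     (_ , red , flat)   refl ()
unshift-step₃ (suc a , b)    (_ , red , flat)   refl _  = refl , refl
unshift-step₃ (a , zero)     (_ , black , flat) refl _  = refl , refl
unshift-step₃ (a , suc b)    (_ , black , flat) refl _  = refl , refl
unshift-step₃ (a , suc b)    (_ , red , down)   refl _  = refl , refl
unshift-step₃ (suc a , zero) (_ , red , down)   refl _  = refl , refl
unshift-step₃ (zero , zero)  (_ , red , down)   refl ()
unshift-step₃ (suc a , b)    (_ , black , down) refl _  = refl , refl
unshift-step₃ (zero , suc b) (_ , black , down) refl ()
unshift-step₃ (zero , zero)  (_ , black , down) refl ()

pop-step₃ : ∀ t {x y} → repl3 x ≡ just y → mark t (proj₂ x) ≡ x →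
            mark t (proj₂ y) ≡ y × next t (proj₂ y) ≡ raise₃ (next t (proj₂ x)) × emit t (proj₂ y) ≡ emit t (proj₂ x)
pop-step₃ (zero , b)     {true , red , flat}   refl refl = refl , refl , refl
pop-step₃ (suc a , b)    {true , red , flat}   refl ()
pop-step₃ (zero , suc b) {true , black , down} refl refl = refl , refl , refl
pop-step₃ (zero , zero)  {true , black , down} refl ()
pop-step₃ (suc a , b)    {true , black , down} refl ()
pop-step₃ t {false , _}          ()
pop-step₃ t {true , red , up}    ()
pop-step₃ t {true , red , down}  ()
pop-step₃ t {true , black , up}  ()
pop-step₃ t {true , black , flat} ()

unpop-step₃ : ∀ t c → proj₁ t ≡ 0 → 0 < proj₁ (next t c) → ∃ λ x → repl3 x ≡ just (mark t c) × mark t (proj₂ x) ≡ x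
unpop-step₃ (zero , b)     (red , up)     refl _  = (true , red , flat) , refl , refl
unpop-step₃ (zero , b)     (black , up)   refl ()
unpop-step₃ (zero , b)     (red , flat)   refl ()
unpop-step₃ (zero , zero)  (black , flat) refl ()
unpop-step₃ (zero , suc b) (black , flat) refl _  = (true , black , down) , refl , refl
unpop-step₃ (zero , suc b) (red , down)   refl ()
unpop-step₃ (zero , zero)  (red , down)   refl ()
unpop-step₃ (zero , suc b) (black , down) refl ()
unpop-step₃ (zero , zero)  (black , down) refl ()

rule₃ : Rule
rule₃ = record
  { repl = repl3 ; raise = raise₃ ; level = proj₁ ; level-origin = refl ; level-raise = λ _ → z<s
  ; raise-injective = λ { refl → refl } ; shift-step = shift-step₃ ; unshift-step = unshift-step₃
  ; pop-step = pop-step₃ ; unpop-step = unpop-step₃ }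

shift-step₄ : ∀ t y → mark t (proj₂ y) ≡ y → repl4 y ≡ nothing →
              mark (raise₄ t) (proj₂ y) ≡ y × next (raise₄ t) (proj₂ y) ≡ raise₄ (next t (proj₂ y))
              × emit (raise₄ t) (proj₂ y) ≡ emit t (proj₂ y)
shift-step₄ t              (_ , red , up)     refl _ = refl , refl , refl
shift-step₄ t              (_ , black , up)   refl _ = refl , refl , refl
shift-step₄ (zero , b)     (_ , red , flat)   refl _ = refl , refl , refl
shift-step₄ (suc a , b)    (_ , red , flat)   refl _ = refl , refl , refl
shift-step₄ (a , zero)     (_ , black , flat) refl ()
shift-step₄ (a , suc b)    (_ , black , flat) refl _ = refl , refl , refl
shift-step₄ (a , suc b)    (_ , red , down)   refl _ = refl , refl , refl
shift-step₄ (suc a , zero) (_ , red , down)   refl ()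
shift-step₄ (zero , zero)  (_ , red , down)   ()   _
shift-step₄ (suc a , b)    (_ , black , down) refl _ = refl , refl , refl
shift-step₄ (zero , suc b) (_ , black , down) refl _ = refl , refl , refl
shift-step₄ (zero , zero)  (_ , black , down) ()   _

unshift-step₄ : ∀ t y → mark (raise₄ t) (proj₂ y) ≡ y → 0 < proj₂ (next (raise₄ t) (proj₂ y)) →
                mark t (proj₂ y) ≡ y × repl4 y ≡ nothing
unshift-step₄ t              (_ , red , up)     refl _  = refl , refl
unshift-step₄ t              (_ , black , up)   refl _  = refl , refl
unshift-step₄ (zero , b)     (_ , red , flat)   refl _  = refl , refl
unshift-step₄ (suc a , b)    (_ , red , flat)   refl _  = refl , refl
unshift-step₄ (a , zero)     (_ , black , flat) refl ()
unshift-step₄ (a , suc b)    (_ , black , flat) refl _  = refl , refl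
unshift-step₄ (a , suc b)    (_ , red , down)   refl _  = refl , refl
unshift-step₄ (suc a , zero) (_ , red , down)   refl ()
unshift-step₄ (zero , zero)  (_ , red , down)   refl ()
unshift-step₄ (suc a , b)    (_ , black , down) refl _  = refl , refl
unshift-step₄ (zero , suc b) (_ , black , down) refl _  = refl , refl
unshift-step₄ (zero , zero)  (_ , black , down) refl ()

pop-step₄ : ∀ t {x y} → repl4 x ≡ just y → mark t (proj₂ x) ≡ x →
            mark t (proj₂ y) ≡ y × next t (proj₂ y) ≡ raise₄ (next t (proj₂ x)) × emit t (proj₂ y) ≡ emit t (proj₂ x)
pop-step₄ (a , zero)     {true , black , flat} refl refl = refl , refl , refl
pop-step₄ (a , suc b)    {true , black , flat} refl ()
pop-step₄ (suc a , zero) {true , red , down}   refl refl = refl , refl , refl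
pop-step₄ (zero , zero)  {true , red , down}   refl ()
pop-step₄ (a , suc b)    {true , red , down}   refl ()
pop-step₄ t {false , _}           ()
pop-step₄ t {true , red , up}     ()
pop-step₄ t {true , red , flat}   ()
pop-step₄ t {true , black , up}   ()
pop-step₄ t {true , black , down} ()

unpop-step₄ : ∀ t c → proj₂ t ≡ 0 → 0 < proj₂ (next t c) → ∃ λ x → repl4 x ≡ just (mark t c) × mark t (proj₂ x) ≡ x
unpop-step₄ (a , zero)     (red , up)     refl ()
unpop-step₄ (a , zero)     (black , up)   refl _  = (true , black , flat) , refl , refl
unpop-step₄ (zero , zero)  (red , flat)   refl ()
unpop-step₄ (suc a , zero) (red , flat)   refl _  = (true , red , down) , refl , refl
unpop-step₄ (a , zero)     (black , flat) refl ()
unpop-step₄ (suc a , zero) (red , down)   refl ()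
unpop-step₄ (zero , zero)  (red , down)   refl ()
unpop-step₄ (suc a , zero) (black , down) refl ()
unpop-step₄ (zero , zero)  (black , down) refl ()

rule₄ : Rule
rule₄ = record
  { repl = repl4 ; raise = raise₄ ; level = proj₂ ; level-origin = refl ; level-raise = λ _ → z<s
  ; raise-injective = λ { refl → refl } ; shift-step = shift-step₄ ; unshift-step = unshift-step₄
  ; pop-step = pop-step₄ ; unpop-step = unpop-step₄ }

repl3-just : ∀ {x y} → repl3 x ≡ just y → repl3 y ≡ nothing × repl4 x ≡ nothing × repl4 y ≡ nothing
repl3-just {true , red , flat}   refl = refl , refl , refl
repl3-just {true , black , down} refl = refl , refl , refl
repl3-just {false , _}           ()
repl3-just {true , red , up}     ()
repl3-just {true , red , down}   ()
repl3-just {true , black , up}   ()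
repl3-just {true , black , flat} ()

repl4-just : ∀ {x y} → repl4 x ≡ just y → repl4 y ≡ nothing × repl3 x ≡ nothing × repl3 y ≡ nothing
repl4-just {true , black , flat} refl = refl , refl , refl
repl4-just {true , red , down}   refl = refl , refl , refl
repl4-just {false , _}           ()
repl4-just {true , red , up}     ()
repl4-just {true , red , flat}   ()
repl4-just {true , black , up}   ()
repl4-just {true , black , down} ()

Position : Set
Position = ℕ × ℕ

InQuarterPlane : Position → List SStep → Set
InQuarterPlane (i , j) = QPFrom i j

Legal : SStep → Position → Set
Legal E  _       = ⊤
Legal N  _       = ⊤
Legal SE (_ , j) = 0 < j
Legal S  (_ , j) = 0 < j
Legal W  (i , _) = 0 < i
Legal NW (i , _) = 0 < i

move : SStep → Position → Position
move E  (i , j) = suc i , j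
move N  (i , j) = i , suc j
move SE (i , j) = suc i , pred j
move S  (i , j) = i , pred j
move W  (i , j) = pred i , j
move NW (i , j) = pred i , suc j

quarterPlane-legal : ∀ s p w → InQuarterPlane p (s ∷ w) → Legal s p
quarterPlane-legal E  _             _ _  = tt
quarterPlane-legal N  _             _ _  = tt
quarterPlane-legal SE (_ , zero)    _ ()
quarterPlane-legal SE (_ , suc _)   _ _  = z<s
quarterPlane-legal S  (_ , zero)    _ ()
quarterPlane-legal S  (_ , suc _)   _ _  = z<s
quarterPlane-legal W  (zero , _)    _ ()
quarterPlane-legal W  (suc _ , _)   _ _  = z<s
quarterPlane-legal NW (zero , _)    _ ()
quarterPlane-legal NW (suc _ , _)   _ _  = z<s

quarterPlane-move : ∀ s p w → Legal s p → InQuarterPlane p (s ∷ w) ≡ InQuarterPlane (move s p) w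
quarterPlane-move E  _           _ _ = refl
quarterPlane-move N  _           _ _ = refl
quarterPlane-move SE (_ , suc _) _ _ = refl
quarterPlane-move S  (_ , suc _) _ _ = refl
quarterPlane-move W  (suc _ , _) _ _ = refl
quarterPlane-move NW (suc _ , _) _ _ = refl

-- A coordinate of the walk counts its increments that are never undone, which are
-- the marked steps matched by rule (4) for the first coordinate, by rule (3) for the second.
position : List MStep → Position
position m = count repl4 m , count repl3 m

position-φstep : ∀ m s → position (φstep m s) ≡ move s (position m)
position-φstep m E  = cong₂ _,_ (count-∷ʳ m _) (count-∷ʳ m _)
position-φstep m N  = cong₂ _,_ (count-∷ʳ m _) (count-∷ʳ m _)
position-φstep m SE = cong₂ _,_ (trans (count-∷ʳ (replaceLast repl3 m) _) (cong suc (count-replaceLast-other (proj₂ ∘ repl3-just) m)))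
                                (trans (count-∷ʳ (replaceLast repl3 m) _) (count-replaceLast (proj₁ ∘ repl3-just) m))
position-φstep m S  = cong₂ _,_ (trans (count-∷ʳ (replaceLast repl3 m) _) (count-replaceLast-other (proj₂ ∘ repl3-just) m))
                                (trans (count-∷ʳ (replaceLast repl3 m) _) (count-replaceLast (proj₁ ∘ repl3-just) m))
position-φstep m W  = cong₂ _,_ (trans (count-∷ʳ (replaceLast repl4 m) _) (count-replaceLast (proj₁ ∘ repl4-just) m))
                                (trans (count-∷ʳ (replaceLast repl4 m) _) (count-replaceLast-other (proj₂ ∘ repl4-just) m))
position-φstep m NW = cong₂ _,_ (trans (count-∷ʳ (replaceLast repl4 m) _) (count-replaceLast (proj₁ ∘ repl4-just) m))
                                (trans (count-∷ʳ (replaceLast repl4 m) _) (cong suc (count-replaceLast-other (proj₂ ∘ repl4-just) m)))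

quarterPlane-φstep : ∀ m s w → Legal s (position m) →
                     InQuarterPlane (position m) (s ∷ w) ≡ InQuarterPlane (position (φstep m s)) w
quarterPlane-φstep m s w legal =
  trans (quarterPlane-move s (position m) w legal) (cong (λ p → InQuarterPlane p w) (sym (position-φstep m s)))

quarterPlane-++ : ∀ w m v → InQuarterPlane (position m) w → InQuarterPlane (position (foldl φstep m w)) v →
                  InQuarterPlane (position m) (w ++ v)
quarterPlane-++ []      m v _ q = q
quarterPlane-++ (s ∷ w) m v q q′ =
  subst id (sym (quarterPlane-φstep m s (w ++ v) legal))
    (quarterPlane-++ w (φstep m s) v (subst id (quarterPlane-φstep m s w legal) q) q′)
  where
    legal : Legal s (position m)
    legal = quarterPlane-legal s (position m) w q

Admissible : List MStep → Set
Admissible m = Canonical (0 , 0) m × endState (0 , 0) (forget m) ≡ (0 , 0)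

walk : List MStep → List SStep
walk m = walkOf (0 , 0) (forget m)

admissible-∷ʳ : ∀ {m t} y → Canonical (0 , 0) m → endState (0 , 0) (forget m) ≡ t →
                mark t (proj₂ y) ≡ y → next t (proj₂ y) ≡ (0 , 0) →
                Admissible (m ++ [ y ]) × walk (m ++ [ y ]) ≡ walk m ++ [ emit t (proj₂ y) ]
admissible-∷ʳ {m} y c refl ok e =
  (canonical-++⁺ (0 , 0) m c (ok , tt) , trans (endState-++ (0 , 0) m [ y ]) e) , walkOf-++ (0 , 0) m [ y ]

admissible-pop-∷ʳ : (rule : Rule) → let open Rule rule in
                    ∀ {m} y → Admissible m → 0 < count repl m →
                    mark (raise (0 , 0)) (proj₂ y) ≡ y → next (raise (0 , 0)) (proj₂ y) ≡ (0 , 0) →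
                    Admissible (replaceLast repl m ++ [ y ])
                    × walk (replaceLast repl m ++ [ y ]) ≡ walk m ++ [ emit (raise (0 , 0)) (proj₂ y) ]
admissible-pop-∷ʳ rule {m} y (c , e) h ok e′ with Popping.pop rule m c h
... | c′ , e-raised , w-same with admissible-∷ʳ y c′ (trans e-raised (cong (Rule.raise rule) e)) ok e′
... | a , w = a , trans w (cong (_++ [ _ ]) w-same)

admissible-φstep : ∀ m s → Admissible m → Legal s (position m) →
                   Admissible (φstep m s) × walk (φstep m s) ≡ walk m ++ [ s ]
admissible-φstep m E  (c , e) _ = admissible-∷ʳ (true , black , flat) c e refl refl
admissible-φstep m N  (c , e) _ = admissible-∷ʳ (true , red , flat) c e refl refl
admissible-φstep m SE a       h = admissible-pop-∷ʳ rule₃ (true , red , down) a h refl refl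
admissible-φstep m S  a       h = admissible-pop-∷ʳ rule₃ (false , black , down) a h refl refl
admissible-φstep m W  a       h = admissible-pop-∷ʳ rule₄ (false , red , down) a h refl refl
admissible-φstep m NW a       h = admissible-pop-∷ʳ rule₄ (true , black , down) a h refl refl

admissible-foldl : ∀ w m → InQuarterPlane (position m) w → Admissible m →
                   Admissible (foldl φstep m w) × walk (foldl φstep m w) ≡ walk m ++ w
admissible-foldl []      m _ a = a , sym (++-identityʳ (walk m))
admissible-foldl (s ∷ w) m q a with quarterPlane-legal s (position m) w q
... | legal with admissible-φstep m s a legal
... | a′ , e with admissible-foldl w (φstep m s) (subst id (quarterPlane-φstep m s w legal) q) a′
... | a″ , e′ = a″ , trans e′ (trans (cong (_++ w) e) (++-assoc (walk m) [ s ] w))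

admissible-φ : ∀ w → InS w → Admissible (φ w) × walk (φ w) ≡ w
admissible-φ w q = admissible-foldl w [] q (tt , refl)

length-φstep : ∀ m s → length (φstep m s) ≡ suc (length m)
length-φstep m E  = length-∷ʳ m _
length-φstep m N  = length-∷ʳ m _
length-φstep m SE = trans (length-∷ʳ (replaceLast repl3 m) _) (cong suc (length-replaceLast m))
length-φstep m S  = trans (length-∷ʳ (replaceLast repl3 m) _) (cong suc (length-replaceLast m))
length-φstep m W  = trans (length-∷ʳ (replaceLast repl4 m) _) (cong suc (length-replaceLast m))
length-φstep m NW = trans (length-∷ʳ (replaceLast repl4 m) _) (cong suc (length-replaceLast m))

length-foldl-φstep : ∀ w m → length (foldl φstep m w) ≡ length m + length w
length-foldl-φstep []      m = sym (+-identityʳ (length m))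
length-foldl-φstep (s ∷ w) m = begin
  length (foldl φstep (φstep m s) w)   ≡⟨ length-foldl-φstep w (φstep m s) ⟩
  length (φstep m s) + length w        ≡⟨ cong (_+ length w) (length-φstep m s) ⟩
  suc (length m) + length w            ≡⟨ sym (+-suc (length m) (length w)) ⟩
  length m + length (s ∷ w)            ∎

height : State → ℕ
height (a , b) = a + b

motzFrom-up : ∀ h p → MotzFrom h (up ∷ p) ≡ MotzFrom (suc h) p
motzFrom-up zero    p = refl
motzFrom-up (suc h) p = refl

motzFrom-flat : ∀ h p → MotzFrom h (flat ∷ p) ≡ MotzFrom h p
motzFrom-flat zero    p = refl
motzFrom-flat (suc h) p = refl

motzFrom-next : ∀ t c p → proj₂ (mark t c) ≡ c → MotzFrom (height t) (proj₂ c ∷ p) ≡ MotzFrom (height (next t c)) p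
motzFrom-next (a , b)        (red , up)     p _ = motzFrom-up (a + b) p
motzFrom-next (a , b)        (black , up)   p _ = trans (motzFrom-up (a + b) p) (cong (λ h → MotzFrom h p) (sym (+-suc a b)))
motzFrom-next (zero , b)     (red , flat)   p _ = motzFrom-flat b p
motzFrom-next (suc a , b)    (red , flat)   p _ = trans (motzFrom-flat (suc a + b) p) (cong (λ h → MotzFrom h p) (sym (+-suc a b)))
motzFrom-next (a , zero)     (black , flat) p _ = motzFrom-flat (a + zero) p
motzFrom-next (a , suc b)    (black , flat) p _ = trans (motzFrom-flat (a + suc b) p) (cong (λ h → MotzFrom h p) (+-suc a b))
motzFrom-next (a , suc b)    (red , down)   p _ = cong (λ h → MotzFrom h (down ∷ p)) (+-suc a b)
motzFrom-next (suc a , zero) (red , down)   p _ = refl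
motzFrom-next (zero , zero)  (red , down)   p ()
motzFrom-next (suc a , b)    (black , down) p _ = refl
motzFrom-next (zero , suc b) (black , down) p _ = refl
motzFrom-next (zero , zero)  (black , down) p ()

motzFrom-valid : ∀ t c p → MotzFrom (height t) (proj₂ c ∷ p) → proj₂ (mark t c) ≡ c
motzFrom-valid t              (red , up)     p _  = refl
motzFrom-valid t              (black , up)   p _  = refl
motzFrom-valid (zero , b)     (red , flat)   p _  = refl
motzFrom-valid (suc a , b)    (red , flat)   p _  = refl
motzFrom-valid (a , zero)     (black , flat) p _  = refl
motzFrom-valid (a , suc b)    (black , flat) p _  = refl
motzFrom-valid (a , suc b)    (red , down)   p _  = refl
motzFrom-valid (suc a , zero) (red , down)   p _  = refl
motzFrom-valid (zero , zero)  (red , down)   p ()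
motzFrom-valid (suc a , b)    (black , down) p _  = refl
motzFrom-valid (zero , suc b) (black , down) p _  = refl
motzFrom-valid (zero , zero)  (black , down) p ()

motzFrom-[] : ∀ t → MotzFrom (height t) [] → t ≡ (0 , 0)
motzFrom-[] (zero , zero) _ = refl

canonical-motzkin : ∀ {t} m → Canonical t m → endState t (forget m) ≡ (0 , 0) → MotzFrom (height t) (map proj₂ (forget m))
canonical-motzkin     []      _        refl = tt
canonical-motzkin {t} (y ∷ m) (ok , c) e    =
  subst id (sym (motzFrom-next t (proj₂ y) _ (cong proj₂ ok))) (canonical-motzkin m c e)

motzkin-marking : ∀ t p → MotzFrom (height t) (map proj₂ p) →
                  forget (marking t p) ≡ p × Canonical t (marking t p) × endState t p ≡ (0 , 0)
motzkin-marking t []      h = refl , tt , motzFrom-[] t h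
motzkin-marking t (c ∷ p) h with motzFrom-valid t c _ h
... | valid with motzkin-marking (next t c) p (subst id (motzFrom-next t c _ valid) h)
... | f , can , e =
  cong₂ _∷_ valid f , (cong (mark t) valid , subst (λ c′ → Canonical (next t c′) (marking (next t c) p)) (sym valid) can) , e

admissible-marking : ∀ p → InM2 p → Admissible (marking (0 , 0) p) × forget (marking (0 , 0) p) ≡ p
admissible-marking p h with motzkin-marking (0 , 0) p h
... | forgets , c , e = (c , subst (λ p′ → endState (0 , 0) p′ ≡ (0 , 0)) (sym forgets) e) , forgets

Recovered : List MStep → Set
Recovered m = InS (walk m) × φ (walk m) ≡ m

recovered-∷ʳ : ∀ {m} s → Recovered m → Legal s (position m) →
               InS (walk m ++ [ s ]) × φ (walk m ++ [ s ]) ≡ φstep m s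
recovered-∷ʳ {m} s (q , e) legal =
  quarterPlane-++ (walk m) [] [ s ] q (subst id (sym (quarterPlane-φstep (φ (walk m)) s [] legal′)) tt) ,
  trans (foldl-++ φstep [] (walk m) [ s ]) (cong (λ m′ → φstep m′ s) e)
  where
    legal′ : Legal s (position (φ (walk m)))
    legal′ = subst (λ m′ → Legal s (position m′)) (sym e) legal

Recovers : ℕ → Set
Recovers n = ∀ m → length m ≡ n → Admissible m → Recovered m

recovered-pop : (rule : Rule) → let open Rule rule in
                ∀ {n} m s y → Recovers n → length m ≡ n → Canonical (0 , 0) m → endState (0 , 0) (forget m) ≡ raise (0 , 0) →
                (∀ m → φstep m s ≡ replaceLast repl m ++ [ y ]) → (∀ m → 0 < count repl m → Legal s (position m)) →
                InS (walk m ++ [ s ]) × φ (walk m ++ [ s ]) ≡ m ++ [ y ]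
recovered-pop rule {n} m s y rec len c e step legal with Popping.unpop rule m c (Rule.level-origin rule) e
... | m₀ , c₀ , e₀ , popped , h with Popping.pop rule m₀ c₀ h
... | _ , _ , w-popped =
  subst (λ v → InS (v ++ [ s ]) × φ (v ++ [ s ]) ≡ m ++ [ y ]) same-walk
    (proj₁ recovered₀ , trans (proj₂ recovered₀) (trans (step m₀) (cong (_++ [ y ]) popped)))
  where
    same-walk : walk m₀ ≡ walk m
    same-walk = trans (sym w-popped) (cong walk popped)
    same-length : length m₀ ≡ n
    same-length = trans (sym (length-replaceLast m₀)) (trans (cong length popped) len)
    recovered₀ : InS (walk m₀ ++ [ s ]) × φ (walk m₀ ++ [ s ]) ≡ φstep m₀ s
    recovered₀ = recovered-∷ʳ s (rec m₀ same-length (c₀ , e₀)) (legal m₀ h)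

recovered-last : ∀ {n} m t y → Recovers n → length m ≡ n → Canonical (0 , 0) m → endState (0 , 0) (forget m) ≡ t →
                 mark t (proj₂ y) ≡ y → next t (proj₂ y) ≡ (0 , 0) →
                 InS (walk m ++ [ emit t (proj₂ y) ]) × φ (walk m ++ [ emit t (proj₂ y) ]) ≡ m ++ [ y ]
recovered-last m (zero , b)     (_ , red , flat)   rec len c e refl refl = recovered-∷ʳ N (rec m len (c , e)) tt
recovered-last m (a , zero)     (_ , black , flat) rec len c e refl refl = recovered-∷ʳ E (rec m len (c , e)) tt
recovered-last m (suc a , zero) (_ , red , down)   rec len c e refl refl =
  recovered-pop rule₃ m SE _ rec len c e (λ _ → refl) (λ _ h → h)
recovered-last m (suc a , b)    (_ , black , down) rec len c e refl refl =
  recovered-pop rule₃ m S _ rec len c e (λ _ → refl) (λ _ h → h)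
recovered-last m (a , suc b)    (_ , red , down)   rec len c e refl refl =
  recovered-pop rule₄ m W _ rec len c e (λ _ → refl) (λ _ h → h)
recovered-last m (zero , suc b) (_ , black , down) rec len c e refl refl =
  recovered-pop rule₄ m NW _ rec len c e (λ _ → refl) (λ _ h → h)
recovered-last m (_ , _)        (_ , red , up)     rec len c e refl ()
recovered-last m (_ , _)        (_ , black , up)   rec len c e refl ()
recovered-last m (suc a , b)    (_ , red , flat)   rec len c e refl ()
recovered-last m (a , suc b)    (_ , black , flat) rec len c e refl ()
recovered-last m (zero , zero)  (_ , red , down)   rec len c e ()   _
recovered-last m (zero , zero)  (_ , black , down) rec len c e ()   _

recovered : ∀ n → Recovers n
recovered n m len a with initLast m
recovered n       .[]          _   _       | []      = tt , refl
recovered zero    .(m ∷ʳ y)   len _       | m ∷ʳ′ y = ⊥-elim (1+n≢0 (trans (sym (length-∷ʳ m y)) len))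
recovered (suc n) .(m ∷ʳ y)   len (c , e) | m ∷ʳ′ y with canonical-++⁻ (0 , 0) m c
... | c-m , y-ok , _ =
  subst (λ v → InS v × φ v ≡ m ++ [ y ]) (sym (walkOf-++ (0 , 0) m [ y ]))
    (recovered-last m _ y (recovered n) (suc-injective (trans (sym (length-∷ʳ m y)) len)) c-m refl y-ok
      (trans (sym (endState-++ (0 , 0) m [ y ])) e))

mainTheorem1 : ((w : List SStep) → InS w → InM2 (forget (φ w)) × length (forget (φ w)) ≡ length w)
    × ((w w′ : List SStep) → InS w → InS w′ → forget (φ w) ≡ forget (φ w′) → w ≡ w′)
    × ((p : List BStep) → InM2 p → ∃ λ w → InS w × forget (φ w) ≡ p)
mainTheorem1 = image , injective , surjective
  where
    image : (w : List SStep) → InS w → InM2 (forget (φ w)) × length (forget (φ w)) ≡ length w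
    image w q = let ((c , e) , _) = admissible-φ w q in
      canonical-motzkin (φ w) c e , trans (length-map proj₂ (φ w)) (length-foldl-φstep w [])
    injective : (w w′ : List SStep) → InS w → InS w′ → forget (φ w) ≡ forget (φ w′) → w ≡ w′
    injective w w′ q q′ eq = begin
      w                ≡⟨ sym (proj₂ (admissible-φ w q)) ⟩
      walk (φ w)       ≡⟨ cong (walkOf (0 , 0)) eq ⟩
      walk (φ w′)      ≡⟨ proj₂ (admissible-φ w′ q′) ⟩
      w′               ∎
    surjective : (p : List BStep) → InM2 p → ∃ λ w → InS w × forget (φ w) ≡ p
    surjective p h =
      let m = marking (0 , 0) p
          (a , forgets) = admissible-marking p h
          (q , φ-walk) = recovered (length m) m refl a
      in walk m , q , trans (cong forget φ-walk) forgets
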